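{- Let $d\ge0$, $m=2^d$, $k\ge1$, let $w$ be a binary word of length $m2^k$ and let $z$ be a binary word of length $m$. Then $w$ is a $(k,m)$-nested perfect necklace if and only if the word $w\oplus z^{2^k}$ is a $(k,m)$-nested perfect necklace.
   Context: Words are over $\mathbb{F}_2=\{0,1\}$; positions numbered from $1$; $\oplus$ is componentwise addition mod $2$ of words of equal length; $z^n$ denotes the concatenation of $n$ copies of $z$. For a word $v$ of length $L$ and $k\le L$, a word $u$ of length $k$ occurs cyclically in $v$ at position $j$ ($1\le j\le L$) if $u$ is the factor of $vv$ of length $k$ starting at position $j$. A binary word $v$ of length $m2^k$ is a $(k,m)$-perfect necklace if every word $u$ of length $k$ occurs cyclically in $v$ exactly $m$ times, at starting positions pairwise incongruent modulo $m$. A binary word $w$ of length $m2^k$ is a $(k,m)$-nested perfect necklace if for each $\ell=1,\dots,k$, every factor of $w$ of length $m2^\ell$ starting at a position congruent to $1$ modulo $m2^\ell$ is an $(\ell,m)$-perfect necklace. -}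

module Defs where

open import Data.Bool using (Bool; false; _xor_)
open import Data.Nat using (ℕ; zero; suc; _+_; _*_; _∸_; _^_; _≤_; _<_)
open import Data.Nat.DivMod using (_mod_; _%_)
open import Data.Vec using (Vec; lookup; tabulate; zipWith; replicate; concat)
open import Data.Fin using (Fin; toℕ)
open import Data.List using (List; length; filter; upTo)
open import Data.Product using (_×_)
open import Relation.Binary.PropositionalEquality using (_≡_)
open import Relation.Nullary using (Dec; yes; no)
open import Relation.Nullary.Decidable using (_×-dec_)
open import Data.Vec.Properties using (≡-dec)
open import Data.Bool.Properties using (_≟_)
open import Data.Nat.Properties using (_<?_)

-- Binary words over F₂ = Bool (false = 0, true = 1).
Word : ℕ → Set
Word n = Vec Bool n

_⊕_ : ∀ {n} → Word n → Word n → Word n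
_⊕_ = zipWith _xor_

cyc : ∀ {L} → Word L → ℕ → Bool
cyc {zero} v i = false
cyc {suc L} v i = lookup v (i mod suc L)

-- z^n : concatenation of n copies of z; its i-th letter (0-based) is z[i mod m].
-- (Length written m * n to match the length m 2^k of w.)
pow : ∀ {m} → Word m → (n : ℕ) → Word (m * n)
pow {m} z n = tabulate (λ (i : Fin (m * n)) → cyc z (toℕ i))

-- u occurs cyclically in v at 0-based position j (the paper's position j+1):
-- u is the factor of v v of length k starting there.
OccursAt : ∀ {k L} → Word k → Word L → ℕ → Set
OccursAt {k} u v j = tabulate (λ (i : Fin k) → cyc v (j + toℕ i)) ≡ u

occursAt? : ∀ {k L} (u : Word k) (v : Word L) (j : ℕ) → Dec (OccursAt u v j)
occursAt? {k} u v j = ≡-dec _≟_ (tabulate (λ (i : Fin k) → cyc v (j + toℕ i))) u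

occCount : ∀ {k L} → Word k → Word L → ℕ
occCount {L = L} u v = length (filter (occursAt? u v) (upTo L))

PerfectNecklace : (k m : ℕ) → Word (m * 2 ^ k) → Set
PerfectNecklace k m v =
  (u : Word k) →
    (occCount u v ≡ m) ×
    (∀ j j' → j < m * 2 ^ k → j' < m * 2 ^ k →
       OccursAt u v j → OccursAt u v j' →
       j % suc (m ∸ 1) ≡ j' % suc (m ∸ 1) → j ≡ j')

-- Factor of w of length n starting at 0-based position s (total: indices read
-- cyclically, which is irrelevant when s + n ≤ length).
factor : ∀ {L} → Word L → (s n : ℕ) → Word n
factor w s n = tabulate (λ (i : Fin n) → cyc w (s + toℕ i))

-- (k,m)-nested perfect necklace: for each ℓ = 1..k, every factor of length
-- m 2^ℓ starting at a position ≡ 1 (mod m 2^ℓ) (1-based), i.e. at 0-based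
-- position b · m 2^ℓ with b < 2^(k-ℓ), is an (ℓ,m)-perfect necklace.
NestedPerfectNecklace : (k m : ℕ) → Word (m * 2 ^ k) → Set
NestedPerfectNecklace k m w =
  (ℓ : ℕ) → 1 ≤ ℓ → ℓ ≤ k →
  (b : ℕ) → b < 2 ^ (k ∸ ℓ) →
  PerfectNecklace ℓ m (factor w (b * (m * 2 ^ ℓ)) (m * 2 ^ ℓ))

{-# OPTIONS --safe #-}
-- Adding the m-periodic word z^(2^k) to w adds the m-periodic word z^(2^ℓ) to every aligned block
-- of length m 2^ℓ, so it suffices that a perfect necklace v stays perfect when a word with period m
-- is added. Adding z shifts the window of length ℓ at position j by the window of z at j mod m; hence
-- the occurrences of u at positions ≡ r (mod m) in the new word are exactly the occurrences of
-- u ⊕ (z-window at r) at those positions in v. In a perfect necklace every word occurs exactly once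
-- in each residue class modulo m, and this property is then inherited. The converse direction is
-- the same statement applied to w ⊕ z^(2^k), since adding z^(2^k) twice is the identity.
module Submission where

open import Defs
open import Data.Nat using (ℕ; zero; suc; _+_; _*_; _^_; _≤_; _<_; z≤n; s≤s; s≤s⁻¹; NonZero)
open import Data.Nat.Properties
open import Data.Nat.DivMod
  using (_%_; _mod_; %-distribˡ-+; m%n%n≡m%n; m%n<n; %-remove-+ˡ; m∣n⇒o%n%m≡o%m)
open import Data.Nat.Divisibility using (_∣_; ∣-trans; n∣m*n; m∣m*n)
open import Data.Bool using (Bool; true; false; _xor_; if_then_else_)
open import Data.Bool.Properties using (xor-assoc; xor-same; xor-identityʳ)
open import Data.Fin as Fin using (Fin; toℕ)
open import Data.Fin.Properties using (toℕ-fromℕ<; fromℕ<-cong)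
open import Data.Vec using ([]; _∷_; lookup; tabulate)
open import Data.Vec.Properties using (lookup∘tabulate; lookup-zipWith; tabulate-cong)
open import Data.List using (length; filter; upTo; _++_; [_])
open import Data.List.Properties using (upTo-∷ʳ; filter-++; length-++; filter-≐; filter-none)
open import Data.List.Relation.Unary.All.Properties using (applyUpTo⁺₁)
open import Data.Product using (_×_; _,_; proj₁; proj₂)
open import Data.Sum using (inj₁; inj₂)
open import Function using (id; _∘_; _⇔_; mk⇔; Equivalence)
open import Level using (0ℓ)
open import Algebra.Properties.CommutativeSemigroup +-commutativeSemigroup using (interchange)
open import Relation.Binary.PropositionalEquality hiding ([_])
open import Relation.Nullary using (Dec; yes; no; does; ¬_; contradiction; _×-dec_)
open import Relation.Unary using (Pred; Decidable; _≐_; _∩_)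
open import Relation.Unary.Properties using (_∩?_)

indicator : {A : Set} → Dec A → ℕ
indicator a = if does a then 1 else 0

indicator-yes : {A : Set} (a : Dec A) → A → indicator a ≡ 1
indicator-yes (yes _) _  = refl
indicator-yes (no ¬x) x  = contradiction x ¬x

indicator-no : {A : Set} (a : Dec A) → ¬ A → indicator a ≡ 0
indicator-no (yes x) ¬x = contradiction x ¬x
indicator-no (no _)  _  = refl

sumBelow : ℕ → (ℕ → ℕ) → ℕ
sumBelow zero    f = 0
sumBelow (suc n) f = sumBelow n f + f n

sumBelow-cong : ∀ n {f g : ℕ → ℕ} → (∀ {r} → r < n → f r ≡ g r) → sumBelow n f ≡ sumBelow n g
sumBelow-cong zero    f≡g = refl
sumBelow-cong (suc n) f≡g = cong₂ _+_ (sumBelow-cong n (f≡g ∘ m<n⇒m<1+n)) (f≡g ≤-refl)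

sumBelow-zero : ∀ n → sumBelow n (λ _ → 0) ≡ 0
sumBelow-zero zero    = refl
sumBelow-zero (suc n) = trans (+-identityʳ _) (sumBelow-zero n)

sumBelow-one : ∀ n → sumBelow n (λ _ → 1) ≡ n
sumBelow-one zero    = refl
sumBelow-one (suc n) = trans (cong (_+ 1) (sumBelow-one n)) (+-comm n 1)

sumBelow-+ : ∀ n (f g : ℕ → ℕ) → sumBelow n (λ r → f r + g r) ≡ sumBelow n f + sumBelow n g
sumBelow-+ zero    f g = refl
sumBelow-+ (suc n) f g = begin
  sumBelow n (λ r → f r + g r) + (f n + g n)   ≡⟨ cong (_+ (f n + g n)) (sumBelow-+ n f g) ⟩
  (sumBelow n f + sumBelow n g) + (f n + g n)  ≡⟨ interchange (sumBelow n f) (sumBelow n g) (f n) (g n) ⟩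
  (sumBelow n f + f n) + (sumBelow n g + g n)  ∎
  where open ≡-Reasoning

sumBelow-≤ : ∀ n {f : ℕ → ℕ} → (∀ {r} → r < n → f r ≤ 1) → sumBelow n f ≤ n
sumBelow-≤ zero    f≤1 = z≤n
sumBelow-≤ (suc n) f≤1 =
  ≤-trans (+-mono-≤ (sumBelow-≤ n (f≤1 ∘ m<n⇒m<1+n)) (f≤1 ≤-refl)) (≤-reflexive (+-comm n 1))

+-tight : ∀ {a b n} → a ≤ n → b ≤ 1 → a + b ≡ suc n → a ≡ n × b ≡ 1
+-tight {a} {zero}     a≤n _ a+0≡1+n =
  contradiction (subst (_≤ _) (trans (sym (+-identityʳ a)) a+0≡1+n) a≤n) 1+n≰n
+-tight {a} {suc zero} _   _ a+1≡1+n = suc-injective (trans (+-comm 1 a) a+1≡1+n) , refl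
+-tight {b = suc (suc _)} _ (s≤s ())

sumBelow≡n⇒all≡1 : ∀ n {f : ℕ → ℕ} → (∀ {r} → r < n → f r ≤ 1) → sumBelow n f ≡ n →
                   ∀ {r} → r < n → f r ≡ 1
sumBelow≡n⇒all≡1 (suc n) f≤1 sum≡1+n r<1+n
  with +-tight (sumBelow-≤ n (f≤1 ∘ m<n⇒m<1+n)) (f≤1 ≤-refl) sum≡1+n
... | sum≡n , fn≡1 with m≤n⇒m<n∨m≡n (s≤s⁻¹ r<1+n)
...   | inj₁ r<n  = sumBelow≡n⇒all≡1 n (f≤1 ∘ m<n⇒m<1+n) sum≡n r<n
...   | inj₂ refl = fn≡1

sumBelow-indicator-≟ : ∀ {c n} → c < n → sumBelow n (λ r → indicator (c ≟ r)) ≡ 1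
sumBelow-indicator-≟ {c} {suc n} c<1+n with c ≟ n
... | yes refl = cong₂ _+_ none (indicator-yes (c ≟ c) refl)
  where
  none : sumBelow c (λ r → indicator (c ≟ r)) ≡ 0
  none = trans (sumBelow-cong c (λ r<c → indicator-no (c ≟ _) (>⇒≢ r<c))) (sumBelow-zero c)
... | no c≢n   =
  cong₂ _+_ (sumBelow-indicator-≟ (≤∧≢⇒< (s≤s⁻¹ c<1+n) c≢n)) (indicator-no (c ≟ n) c≢n)

HasResidue : (m : ℕ) .{{_ : NonZero m}} → ℕ → Pred ℕ 0ℓ
HasResidue m r j = j % m ≡ r

hasResidue? : (m : ℕ) .{{_ : NonZero m}} (r : ℕ) → Decidable (HasResidue m r)
hasResidue? m r j = j % m ≟ r

sumBelow-indicator-residue : ∀ m .{{_ : NonZero m}} {A : Set} (a : Dec A) j →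
  sumBelow m (λ r → indicator (a ×-dec hasResidue? m r j)) ≡ indicator a
sumBelow-indicator-residue m (yes _) j = sumBelow-indicator-≟ (m%n<n j m)
sumBelow-indicator-residue m (no _)  j = sumBelow-zero m

count< : {P : Pred ℕ 0ℓ} → Decidable P → ℕ → ℕ
count< P? n = length (filter P? (upTo n))

count<-suc : ∀ {P : Pred ℕ 0ℓ} (P? : Decidable P) n →
  count< P? (suc n) ≡ count< P? n + indicator (P? n)
count<-suc P? n = begin
  length (filter P? (upTo (suc n)))               ≡⟨ cong (length ∘ filter P?) (upTo-∷ʳ n) ⟨
  length (filter P? (upTo n ++ [ n ]))             ≡⟨ cong length (filter-++ P? (upTo n) [ n ]) ⟩
  length (filter P? (upTo n) ++ filter P? [ n ])   ≡⟨ length-++ (filter P? (upTo n)) ⟩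
  count< P? n + length (filter P? [ n ])           ≡⟨ cong (count< P? n +_) singleton ⟩
  count< P? n + indicator (P? n)                   ∎
  where
  open ≡-Reasoning
  singleton : length (filter P? [ n ]) ≡ indicator (P? n)
  singleton with does (P? n)
  ... | true  = refl
  ... | false = refl

count<-≐ : ∀ {P Q : Pred ℕ 0ℓ} (P? : Decidable P) (Q? : Decidable Q) → P ≐ Q →
  ∀ n → count< P? n ≡ count< Q? n
count<-≐ P? Q? P≐Q n = cong length (filter-≐ P? Q? P≐Q (upTo n))

count<-none : ∀ {P : Pred ℕ 0ℓ} (P? : Decidable P) n → (∀ {j} → j < n → ¬ P j) → count< P? n ≡ 0
count<-none P? n ¬P = cong length (filter-none P? (applyUpTo⁺₁ id n ¬P))

count<-≤1 : ∀ {P : Pred ℕ 0ℓ} (P? : Decidable P) n →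
  (∀ {i j} → i < n → j < n → P i → P j → i ≡ j) → count< P? n ≤ 1
count<-≤1 P? zero _ = z≤n
count<-≤1 {P} P? (suc n) unique = subst (_≤ 1) (sym (count<-suc P? n)) (bound (P? n))
  where
  bound : (Pn? : Dec (P n)) → count< P? n + indicator Pn? ≤ 1
  bound (yes Pn) = ≤-reflexive (cong (_+ 1) (count<-none P? n
    (λ j<n Pj → <⇒≢ j<n (unique (m<n⇒m<1+n j<n) ≤-refl Pj Pn))))
  bound (no _)   = subst (_≤ 1) (sym (+-identityʳ _))
    (count<-≤1 P? n (λ i<n j<n → unique (m<n⇒m<1+n i<n) (m<n⇒m<1+n j<n)))

count<-by-residue : ∀ {P : Pred ℕ 0ℓ} (P? : Decidable P) m .{{_ : NonZero m}} n →
  count< P? n ≡ sumBelow m (λ r → count< (P? ∩? hasResidue? m r) n)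
count<-by-residue P? m zero    = sym (sumBelow-zero m)
count<-by-residue P? m (suc n) = begin
  count< P? (suc n)                ≡⟨ count<-suc P? n ⟩
  count< P? n + indicator (P? n)   ≡⟨ cong₂ _+_ (count<-by-residue P? m n)
                                                (sym (sumBelow-indicator-residue m (P? n) n)) ⟩
  sumBelow m C + sumBelow m I      ≡⟨ sumBelow-+ m C I ⟨
  sumBelow m (λ r → C r + I r)     ≡⟨ sumBelow-cong m (λ {r} _ → count<-suc (P? ∩? hasResidue? m r) n) ⟨
  sumBelow m (λ r → count< (P? ∩? hasResidue? m r) (suc n)) ∎
  where
  open ≡-Reasoning
  C I : ℕ → ℕ
  C r = count< (P? ∩? hasResidue? m r) n
  I r = indicator ((P? ∩? hasResidue? m r) n)

xor-cancelʳ : ∀ a b → (a xor b) xor b ≡ a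
xor-cancelʳ a b = trans (xor-assoc a b b) (trans (cong (a xor_) (xor-same b)) (xor-identityʳ a))

⊕-cancelʳ : ∀ {n} (x y : Word n) → (x ⊕ y) ⊕ y ≡ x
⊕-cancelʳ []      []      = refl
⊕-cancelʳ (a ∷ x) (b ∷ y) = cong₂ _∷_ (xor-cancelʳ a b) (⊕-cancelʳ x y)

tabulate-⊕ : ∀ {n} (f g : Fin n → Bool) → tabulate f ⊕ tabulate g ≡ tabulate (λ i → f i xor g i)
tabulate-⊕ {zero}  f g = refl
tabulate-⊕ {suc n} f g =
  cong ((f Fin.zero xor g Fin.zero) ∷_) (tabulate-⊕ (f ∘ Fin.suc) (g ∘ Fin.suc))

cyc-⊕ : ∀ {L} (v w : Word L) x → cyc (v ⊕ w) x ≡ cyc v x xor cyc w x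
cyc-⊕ {zero}  v w x = refl
cyc-⊕ {suc L} v w x = lookup-zipWith _xor_ (x mod suc L) v w

cyc-cong : ∀ {L} .{{_ : NonZero L}} (v : Word L) {x y} → x % L ≡ y % L → cyc v x ≡ cyc v y
cyc-cong {suc L} v {x} {y} x≡y = cong (lookup v) (fromℕ<-cong (x % suc L) (y % suc L) x≡y _ _)

cyc-tabulate : ∀ {L} .{{_ : NonZero L}} (f : ℕ → Bool) x →
  cyc (tabulate {n = L} (f ∘ toℕ)) x ≡ f (x % L)
cyc-tabulate {suc L} f x = trans (lookup∘tabulate (f ∘ toℕ) (x mod suc L)) (cong f (toℕ-fromℕ< _))

cyc-factor : ∀ {L} (v : Word L) s n .{{_ : NonZero n}} x → cyc (factor v s n) x ≡ cyc v (s + x % n)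
cyc-factor v s n x = cyc-tabulate (λ i → cyc v (s + i)) x

cyc-pow : ∀ {m} .{{_ : NonZero m}} (z : Word m) N .{{_ : NonZero N}} x → cyc (pow z N) x ≡ cyc z x
cyc-pow {m} z N x =
  trans (cyc-tabulate {m * N} (cyc z) x) (cyc-cong z (m∣n⇒o%n%m≡o%m m (m * N) x (m∣m*n N)))
  where
  instance
    mN≢0 : NonZero (m * N)
    mN≢0 = m*n≢0 m N

cyc-factor-⊕-pow : ∀ {m N} .{{_ : NonZero m}} .{{_ : NonZero N}} (w : Word (m * N)) (z : Word m)
  {s n} .{{_ : NonZero n}} → m ∣ s → m ∣ n →
  ∀ x → cyc (factor (w ⊕ pow z N) s n) x ≡ cyc (factor w s n) x xor cyc z x
cyc-factor-⊕-pow {m} {N} w z {s} {n} m∣s m∣n x = begin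
  cyc (factor (w ⊕ pow z N) s n) x                 ≡⟨ cyc-factor (w ⊕ pow z N) s n x ⟩
  cyc (w ⊕ pow z N) (s + x % n)                    ≡⟨ cyc-⊕ w (pow z N) (s + x % n) ⟩
  cyc w (s + x % n) xor cyc (pow z N) (s + x % n)  ≡⟨ cong₂ _xor_ (cyc-factor w s n x)
                                                                  (sym (cyc-pow z N (s + x % n))) ⟨
  cyc (factor w s n) x xor cyc z (s + x % n)       ≡⟨ cong (cyc (factor w s n) x xor_) (cyc-cong z residue) ⟩
  cyc (factor w s n) x xor cyc z x                 ∎
  where
  open ≡-Reasoning
  residue : (s + x % n) % m ≡ x % m
  residue = trans (%-remove-+ˡ (x % n) m∣s) (m∣n⇒o%n%m≡o%m m n x m∣n)

factor-⊕ : ∀ {L m} {v v' : Word L} (z : Word m) → (∀ x → cyc v' x ≡ cyc v x xor cyc z x) →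
  ∀ s n → factor v' s n ≡ factor v s n ⊕ factor z s n
factor-⊕ z shift s n = trans (tabulate-cong (λ i → shift (s + toℕ i))) (sym (tabulate-⊕ _ _))

factor-cong : ∀ {m} .{{_ : NonZero m}} (z : Word m) s s' n → s % m ≡ s' % m →
  factor z s n ≡ factor z s' n
factor-cong {m} z s s' n s≡s' = tabulate-cong (λ i → cyc-cong z (shifted (toℕ i)))
  where
  open ≡-Reasoning
  shifted : ∀ i → (s + i) % m ≡ (s' + i) % m
  shifted i = begin
    (s + i) % m            ≡⟨ %-distribˡ-+ s i m ⟩
    (s % m + i % m) % m    ≡⟨ cong (λ t → (t + i % m) % m) s≡s' ⟩
    (s' % m + i % m) % m   ≡⟨ %-distribˡ-+ s' i m ⟨
    (s' + i) % m           ∎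

factor-residue : ∀ {m} .{{_ : NonZero m}} (z : Word m) n {j r} → j % m ≡ r →
  factor z j n ≡ factor z r n
factor-residue {m} z n {j} j≡r =
  trans (factor-cong z j (j % m) n (sym (m%n%n≡m%n j m))) (cong (λ t → factor z t n) j≡r)

occursAt-⊕ : ∀ {k L m} {v v' : Word L} (z : Word m) → (∀ x → cyc v' x ≡ cyc v x xor cyc z x) →
  ∀ {u : Word k} j → OccursAt u v' j ⇔ OccursAt (u ⊕ factor z j k) v j
occursAt-⊕ {k} {v = v} {v'} z shift {u} j = mk⇔ to from
  where
  open ≡-Reasoning
  window : factor v' j k ≡ factor v j k ⊕ factor z j k
  window = factor-⊕ {v = v} {v'} z shift j k
  to : factor v' j k ≡ u → factor v j k ≡ u ⊕ factor z j k
  to occ = begin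
    factor v j k                                  ≡⟨ ⊕-cancelʳ (factor v j k) (factor z j k) ⟨
    (factor v j k ⊕ factor z j k) ⊕ factor z j k  ≡⟨ cong (_⊕ factor z j k) (trans (sym window) occ) ⟩
    u ⊕ factor z j k                              ∎
  from : factor v j k ≡ u ⊕ factor z j k → factor v' j k ≡ u
  from occ = begin
    factor v' j k                                 ≡⟨ window ⟩
    factor v j k ⊕ factor z j k                   ≡⟨ cong (_⊕ factor z j k) occ ⟩
    (u ⊕ factor z j k) ⊕ factor z j k             ≡⟨ ⊕-cancelʳ u (factor z j k) ⟩
    u                                             ∎

occursAt-⊕-residue : ∀ {k L m} .{{_ : NonZero m}} {v v' : Word L} (z : Word m) →
  (∀ x → cyc v' x ≡ cyc v x xor cyc z x) →
  ∀ {u : Word k} {j r} → j % m ≡ r → OccursAt u v' j ⇔ OccursAt (u ⊕ factor z r k) v j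
occursAt-⊕-residue {k} {v = v} {v'} z shift {u} {j} j≡r =
  subst (λ y → OccursAt u v' j ⇔ OccursAt (u ⊕ y) v j) (factor-residue z k j≡r)
        (occursAt-⊕ {v = v} {v'} z shift j)

occCountMod : ∀ {k L} → Word k → Word L → (m : ℕ) .{{_ : NonZero m}} → ℕ → ℕ
occCountMod {L = L} u v m r = count< (occursAt? u v ∩? hasResidue? m r) L

occCountMod≡1⇒occCount≡ : ∀ {k L} {u : Word k} {v : Word L} m .{{_ : NonZero m}} →
  (∀ {r} → r < m → occCountMod u v m r ≡ 1) → occCount u v ≡ m
occCountMod≡1⇒occCount≡ {L = L} {u} {v} m each≡1 =
  trans (count<-by-residue (occursAt? u v) m L) (trans (sumBelow-cong m each≡1) (sumBelow-one m))

perfect⇒occCountMod≡1 : ∀ {ℓ p} {v : Word (suc p * 2 ^ ℓ)} → PerfectNecklace ℓ (suc p) v →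
  ∀ u {r} → r < suc p → occCountMod u v (suc p) r ≡ 1
perfect⇒occCountMod≡1 {ℓ} {p} {v} perfect u = sumBelow≡n⇒all≡1 (suc p) atMostOne total
  where
  L = suc p * 2 ^ ℓ
  atMostOne : ∀ {r} → r < suc p → occCountMod u v (suc p) r ≤ 1
  atMostOne {r} _ = count<-≤1 (occursAt? u v ∩? hasResidue? (suc p) r) L
    λ i<L j<L (occ-i , i≡r) (occ-j , j≡r) →
      proj₂ (perfect u) _ _ i<L j<L occ-i occ-j (trans i≡r (sym j≡r))
  total : sumBelow (suc p) (occCountMod u v (suc p)) ≡ suc p
  total = trans (sym (count<-by-residue (occursAt? u v) (suc p) L)) (proj₁ (perfect u))

-- Matching m as suc p makes the modulus suc (m ∸ 1) of PerfectNecklace literally m.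
perfect-⊕-periodic : ∀ {ℓ m} .{{_ : NonZero m}} {v v' : Word (m * 2 ^ ℓ)} (z : Word m) →
  (∀ x → cyc v' x ≡ cyc v x xor cyc z x) → PerfectNecklace ℓ m v → PerfectNecklace ℓ m v'
perfect-⊕-periodic {ℓ} {suc p} {v} {v'} z shift perfect u = count , distinct
  where
  open Equivalence using (to; from)
  L = suc p * 2 ^ ℓ

  transfer : ∀ {j r} → j % suc p ≡ r → OccursAt u v' j ⇔ OccursAt (u ⊕ factor z r ℓ) v j
  transfer = occursAt-⊕-residue {v = v} {v'} z shift

  sameOccurrences : ∀ r → (OccursAt u v' ∩ HasResidue (suc p) r)
                        ≐ (OccursAt (u ⊕ factor z r ℓ) v ∩ HasResidue (suc p) r)
  sameOccurrences r = (λ (occ , j≡r) → to (transfer j≡r) occ , j≡r)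
                    , (λ (occ , j≡r) → from (transfer j≡r) occ , j≡r)

  count : occCount u v' ≡ suc p
  count = occCountMod≡1⇒occCount≡ {u = u} {v'} (suc p) λ {r} r<m → begin
    occCountMod u v' (suc p) r
      ≡⟨ count<-≐ _ (occursAt? (u ⊕ factor z r ℓ) v ∩? hasResidue? (suc p) r) (sameOccurrences r) L ⟩
    occCountMod (u ⊕ factor z r ℓ) v (suc p) r
      ≡⟨ perfect⇒occCountMod≡1 perfect (u ⊕ factor z r ℓ) r<m ⟩
    1 ∎
    where open ≡-Reasoning

  distinct : ∀ j j' → j < L → j' < L → OccursAt u v' j → OccursAt u v' j' →
             j % suc p ≡ j' % suc p → j ≡ j'
  distinct j j' j<L j'<L occ occ' j≡j' = proj₂ (perfect (u ⊕ factor z (j % suc p) ℓ)) j j' j<L j'<L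
    (to (transfer refl) occ) (to (transfer (sym j≡j')) occ') j≡j'

nested-⊕-pow : ∀ k {m} .{{_ : NonZero m}} (w : Word (m * 2 ^ k)) (z : Word m) →
  NestedPerfectNecklace k m w → NestedPerfectNecklace k m (w ⊕ pow z (2 ^ k))
nested-⊕-pow k {m} w z nested ℓ 1≤ℓ ℓ≤k b b<2^[k-ℓ] =
  perfect-⊕-periodic z
    (cyc-factor-⊕-pow w z (∣-trans (m∣m*n (2 ^ ℓ)) (n∣m*n b)) (m∣m*n (2 ^ ℓ)))
    (nested ℓ 1≤ℓ ℓ≤k b b<2^[k-ℓ])
  where
  instance
    2^k≢0 : NonZero (2 ^ k)
    2^k≢0 = m^n≢0 2 k
    2^ℓ≢0 : NonZero (2 ^ ℓ)
    2^ℓ≢0 = m^n≢0 2 ℓ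
    m2^ℓ≢0 : NonZero (m * 2 ^ ℓ)
    m2^ℓ≢0 = m*n≢0 m (2 ^ ℓ)

lemma6 : (d k : ℕ) → 1 ≤ k → (w : Word (2 ^ d * 2 ^ k)) → (z : Word (2 ^ d)) →
    NestedPerfectNecklace k (2 ^ d) w ⇔ NestedPerfectNecklace k (2 ^ d) (w ⊕ pow z (2 ^ k))
lemma6 d k _ w z = mk⇔ (nested-⊕-pow k w z) backward
  where
  instance
    2^d≢0 : NonZero (2 ^ d)
    2^d≢0 = m^n≢0 2 d
  backward : NestedPerfectNecklace k (2 ^ d) (w ⊕ pow z (2 ^ k)) → NestedPerfectNecklace k (2 ^ d) w
  backward = subst (NestedPerfectNecklace k (2 ^ d)) (⊕-cancelʳ w (pow z (2 ^ k)))
           ∘ nested-⊕-pow k (w ⊕ pow z (2 ^ k)) z
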